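{- For every $A\subseteq\omega^\omega$ and every Turing ideal $\mathcal{I}$, $\mathcal{B}_{\mathcal{I}}(A)=\mathcal{B}_{\mathcal{I}}(\mathcal{B}_{\mathcal{I}}(A))$.
   Context: A Turing functional $\Phi$ is $h$-bounded if for all $x$ and $m$, $\Phi(x)(m)\downarrow$ implies $\Phi(x)(m)\le h(m)$. $\mathcal{B}_{\mathcal{I}}$ denotes the set of Turing functionals in $\mathcal{I}$ (computable relative to an oracle in $\mathcal{I}$) which are $h$-bounded for some $h\in\mathcal{I}$, and $\mathcal{B}_{\mathcal{I}}(A)=\{g\in\omega^\omega:\exists\Phi\in\mathcal{B}_{\mathcal{I}}\ \exists f\in A\ g=\Phi(f)\}$. -}

module Defs where

open import Data.Nat using (ℕ; zero; suc; _≤_; _<_; _*_; _+_)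
open import Data.Fin using (Fin)
open import Data.Vec using (Vec; []; _∷_; lookup)
open import Data.Product using (Σ; ∃; _×_; _,_)
open import Relation.Binary.PropositionalEquality using (_≡_)
open import Relation.Unary using (Pred)
open import Level using (0ℓ)

Baire : Set
Baire = ℕ → ℕ

-- Partial recursive terms (μ-recursive functions) of a given arity,
-- with access to two oracles: a parameter oracle Z and the input oracle X.
data PR : ℕ → Set where
  zer  : ∀ {n} → PR n
  succ : PR 1
  proj : ∀ {n} → Fin n → PR n
  oraZ : PR 1
  oraX : PR 1
  comp : ∀ {m n} → PR m → Vec (PR n) m → PR n
  prec : ∀ {n} → PR n → PR (suc (suc n)) → PR (suc n)
  mu   : ∀ {n} → PR (suc n) → PR n

mutual
  data Eval (Z X : Baire) : ∀ {n} → PR n → Vec ℕ n → ℕ → Set where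
    ev-zer  : ∀ {n} {as : Vec ℕ n} → Eval Z X zer as 0
    ev-succ : ∀ {a} → Eval Z X succ (a ∷ []) (suc a)
    ev-proj : ∀ {n} {i : Fin n} {as} → Eval Z X (proj i) as (lookup as i)
    ev-oraZ : ∀ {a} → Eval Z X oraZ (a ∷ []) (Z a)
    ev-oraX : ∀ {a} → Eval Z X oraX (a ∷ []) (X a)
    ev-comp : ∀ {m n} {f : PR m} {gs : Vec (PR n) m} {as bs y} →
              EvalVec Z X gs as bs → Eval Z X f bs y → Eval Z X (comp f gs) as y
    ev-prec-z : ∀ {n} {f : PR n} {g} {as y} →
              Eval Z X f as y → Eval Z X (prec f g) (0 ∷ as) y
    ev-prec-s : ∀ {n} {f : PR n} {g} {k as r y} →
              Eval Z X (prec f g) (k ∷ as) r → Eval Z X g (k ∷ r ∷ as) y →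
              Eval Z X (prec f g) (suc k ∷ as) y
    ev-mu   : ∀ {n} {f : PR (suc n)} {as y} →
              Eval Z X f (y ∷ as) 0 →
              (∀ z → z < y → Σ ℕ λ v → Eval Z X f (z ∷ as) (suc v)) →
              Eval Z X (mu f) as y

  data EvalVec (Z X : Baire) {n : ℕ} : ∀ {m} → Vec (PR n) m → Vec ℕ n → Vec ℕ m → Set where
    ev-[] : ∀ {as} → EvalVec Z X [] as []
    ev-∷  : ∀ {m} {g} {gs : Vec (PR n) m} {as b bs} →
            Eval Z X g as b → EvalVec Z X gs as bs → EvalVec Z X (g ∷ gs) as (b ∷ bs)

_≤T_ : Baire → Baire → Set
y ≤T x = Σ (PR 1) λ e → ∀ n → Eval x x e (n ∷ []) (y n)

-- Join x ⊕ y :  (x ⊕ y)(2n) = x n,  (x ⊕ y)(2n+1) = y n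
_⊕_ : Baire → Baire → Baire
(x ⊕ y) zero = x zero
(x ⊕ y) (suc n) = ((λ k → y k) ⊕ (λ k → x (suc k))) n

record IsTuringIdeal (I : Pred Baire 0ℓ) : Set where
  field
    nonempty   : Σ Baire I
    join-closed : ∀ {x y} → I x → I y → I (x ⊕ y)
    down-closed : ∀ {x y} → I x → y ≤T x → I y

-- A Turing functional in I: a program e together with a parameter oracle Z ∈ I;
-- Φ(X)(m) is e^{Z,X}(m).
record Functional : Set where
  constructor ⟨_,_⟩
  field
    param : Baire
    code  : PR 1

_⟦_⟧_↦_ : Functional → Baire → ℕ → ℕ → Set
⟨ Z , e ⟩ ⟦ x ⟧ m ↦ v = Eval Z x e (m ∷ []) v

Bounded : Baire → Functional → Set
Bounded h Φ = ∀ x m v → Φ ⟦ x ⟧ m ↦ v → v ≤ h m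

_computes_from_ : Functional → Baire → Baire → Set
Φ computes g from f = ∀ m → Φ ⟦ f ⟧ m ↦ g m

InB : Pred Baire 0ℓ → Functional → Set
InB I Φ = I (Functional.param Φ) × Σ Baire λ h → I h × Bounded h Φ

B : Pred Baire 0ℓ → Pred Baire 0ℓ → Pred Baire 0ℓ
B I A g = Σ Functional λ Φ → InB I Φ × Σ Baire λ f → A f × Φ computes g from f

-- Two operations on functionals give both inclusions.  Composition Ψ ∘ Φ, with parameter
-- the join of the two parameters, runs Ψ and answers each of its oracle queries by running Φ,
-- so it computes Ψ(Φ(f)) from f.  It need not be bounded, since on inputs x where Φ(x) is
-- partial the boundedness of Ψ says nothing; this is repaired by clamping: replacing the
-- output Φ(x)(m) by min(Φ(x)(m), h(m)) makes any functional h-bounded at the cost of adding h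
-- to its parameter, and leaves Φ(f) unchanged whenever Φ(f) ≤ h.  Hence Ψ ∘ Φ clamped by the
-- bound of Ψ witnesses B_I(B_I(A)) ⊆ B_I(A), and the identity functional clamped by the bound
-- of Φ witnesses B_I(A) ⊆ B_I(B_I(A)).
module Submission where

open import Defs
open import Relation.Unary using (Pred; _≐_)
open import Level using (0ℓ)
open import Data.Nat using (ℕ; zero; suc; _≤_; _∸_; _⊓_; pred)
open import Data.Nat.Properties
  using (<-cmp; ≤-total; m∸[m∸n]≡n; m≤n⇒m∸n≡0; m≥n⇒m⊓n≡n; m≤n⇒m⊓n≡m; m⊓n≤n; pred[m∸n]≡m∸[1+n])
open import Data.Fin using () renaming (zero to #0; suc to #suc)
open import Data.Vec using (Vec; []; _∷_)
open import Data.Product using (_,_; proj₁; proj₂)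
open import Data.Sum using (inj₁; inj₂)
open import Relation.Binary using (tri<; tri≈; tri>)
open import Relation.Binary.PropositionalEquality using (_≡_; refl; sym; trans; cong₂; subst)

open Functional

mutual
  Eval-deterministic : ∀ {Z X n} {e : PR n} {as y₁ y₂} →
                       Eval Z X e as y₁ → Eval Z X e as y₂ → y₁ ≡ y₂
  Eval-deterministic ev-zer ev-zer = refl
  Eval-deterministic ev-succ ev-succ = refl
  Eval-deterministic ev-proj ev-proj = refl
  Eval-deterministic ev-oraZ ev-oraZ = refl
  Eval-deterministic ev-oraX ev-oraX = refl
  Eval-deterministic (ev-comp gs₁ f₁) (ev-comp gs₂ f₂)
    with refl ← EvalVec-deterministic gs₁ gs₂ = Eval-deterministic f₁ f₂
  Eval-deterministic (ev-prec-z f₁) (ev-prec-z f₂) = Eval-deterministic f₁ f₂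
  Eval-deterministic (ev-prec-s r₁ g₁) (ev-prec-s r₂ g₂)
    with refl ← Eval-deterministic r₁ r₂ = Eval-deterministic g₁ g₂
  Eval-deterministic (ev-mu {y = y₁} zero₁ below₁) (ev-mu {y = y₂} zero₂ below₂)
    with <-cmp y₁ y₂
  ... | tri< y₁<y₂ _ _ with () ← Eval-deterministic zero₁ (proj₂ (below₂ y₁ y₁<y₂))
  ... | tri≈ _ y₁≡y₂ _ = y₁≡y₂
  ... | tri> _ _ y₁>y₂ with () ← Eval-deterministic (proj₂ (below₁ y₂ y₁>y₂)) zero₂

  EvalVec-deterministic : ∀ {Z X n m} {gs : Vec (PR n) m} {as bs₁ bs₂} →
                          EvalVec Z X gs as bs₁ → EvalVec Z X gs as bs₂ → bs₁ ≡ bs₂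
  EvalVec-deterministic ev-[] ev-[] = refl
  EvalVec-deterministic (ev-∷ g₁ gs₁) (ev-∷ g₂ gs₂) =
    cong₂ _∷_ (Eval-deterministic g₁ g₂) (EvalVec-deterministic gs₁ gs₂)

m∸[m∸n]≡m⊓n : ∀ m n → m ∸ (m ∸ n) ≡ m ⊓ n
m∸[m∸n]≡m⊓n m n with ≤-total n m
... | inj₁ n≤m = trans (m∸[m∸n]≡n n≤m) (sym (m≥n⇒m⊓n≡n n≤m))
... | inj₂ m≤n rewrite m≤n⇒m∸n≡0 m≤n = sym (m≤n⇒m⊓n≡m m≤n)

double : ℕ → ℕ
double zero = zero
double (suc n) = suc (suc (double n))

pred-prog : PR 1
pred-prog = prec zer (proj #0)

monus-prog : PR 2
monus-prog = prec (proj #0) (comp pred-prog (proj (#suc #0) ∷ []))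

min-prog : PR 2
min-prog = comp monus-prog (comp monus-prog (proj (#suc #0) ∷ proj #0 ∷ []) ∷ proj #0 ∷ [])

double-prog : PR 1
double-prog = prec zer (comp succ (comp succ (proj (#suc #0) ∷ []) ∷ []))

module _ {Z X : Baire} where

  Eval-pred-prog : ∀ n → Eval Z X pred-prog (n ∷ []) (pred n)
  Eval-pred-prog zero = ev-prec-z ev-zer
  Eval-pred-prog (suc n) = ev-prec-s (Eval-pred-prog n) ev-proj

  Eval-monus-prog : ∀ n m → Eval Z X monus-prog (n ∷ m ∷ []) (m ∸ n)
  Eval-monus-prog zero m = ev-prec-z ev-proj
  Eval-monus-prog (suc n) m = subst (Eval Z X monus-prog (suc n ∷ m ∷ [])) (pred[m∸n]≡m∸[1+n] m n)
    (ev-prec-s (Eval-monus-prog n m) (ev-comp (ev-∷ ev-proj ev-[]) (Eval-pred-prog (m ∸ n))))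

  Eval-min-prog : ∀ m n → Eval Z X min-prog (m ∷ n ∷ []) (m ⊓ n)
  Eval-min-prog m n = subst (Eval Z X min-prog (m ∷ n ∷ [])) (m∸[m∸n]≡m⊓n m n)
    (ev-comp (ev-∷ (ev-comp (ev-∷ ev-proj (ev-∷ ev-proj ev-[])) (Eval-monus-prog n m))
                   (ev-∷ ev-proj ev-[]))
             (Eval-monus-prog (m ∸ n) m))

  Eval-double-prog : ∀ n → Eval Z X double-prog (n ∷ []) (double n)
  Eval-double-prog zero = ev-prec-z ev-zer
  Eval-double-prog (suc n) = ev-prec-s (Eval-double-prog n)
    (ev-comp (ev-∷ (ev-comp (ev-∷ ev-proj ev-[]) ev-succ) ev-[]) ev-succ)

⊕-double : ∀ (x y : Baire) n → (x ⊕ y) (double n) ≡ x n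
⊕-double x y zero = refl
⊕-double x y (suc n) = ⊕-double (λ k → x (suc k)) (λ k → y (suc k)) n

⊕-suc-double : ∀ (x y : Baire) n → (x ⊕ y) (suc (double n)) ≡ y n
⊕-suc-double x y zero = refl
⊕-suc-double x y (suc n) = ⊕-suc-double (λ k → x (suc k)) (λ k → y (suc k)) n

readLeft : PR 1
readLeft = comp oraZ (double-prog ∷ [])

readRight : PR 1
readRight = comp oraZ (comp succ (double-prog ∷ []) ∷ [])

module _ {Z₁ Z₂ X : Baire} where

  readLeft-computes : ⟨ Z₁ ⊕ Z₂ , readLeft ⟩ computes Z₁ from X
  readLeft-computes n = subst (Eval (Z₁ ⊕ Z₂) X readLeft (n ∷ [])) (⊕-double Z₁ Z₂ n)
    (ev-comp (ev-∷ (Eval-double-prog n) ev-[]) ev-oraZ)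

  readRight-computes : ⟨ Z₁ ⊕ Z₂ , readRight ⟩ computes Z₂ from X
  readRight-computes n = subst (Eval (Z₁ ⊕ Z₂) X readRight (n ∷ [])) (⊕-suc-double Z₁ Z₂ n)
    (ev-comp (ev-∷ (ev-comp (ev-∷ (Eval-double-prog n) ev-[]) ev-succ) ev-[]) ev-oraZ)

oraX-computes : ∀ {Z X} → ⟨ Z , oraX ⟩ computes X from X
oraX-computes n = ev-oraX

mutual
  replaceOracles : ∀ {n} → PR n → PR 1 → PR 1 → PR n
  replaceOracles zer oZ oX = zer
  replaceOracles succ oZ oX = succ
  replaceOracles (proj i) oZ oX = proj i
  replaceOracles oraZ oZ oX = oZ
  replaceOracles oraX oZ oX = oX
  replaceOracles (comp f gs) oZ oX = comp (replaceOracles f oZ oX) (replaceOraclesVec gs oZ oX)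
  replaceOracles (prec f g) oZ oX = prec (replaceOracles f oZ oX) (replaceOracles g oZ oX)
  replaceOracles (mu f) oZ oX = mu (replaceOracles f oZ oX)

  replaceOraclesVec : ∀ {n m} → Vec (PR n) m → PR 1 → PR 1 → Vec (PR n) m
  replaceOraclesVec [] oZ oX = []
  replaceOraclesVec (g ∷ gs) oZ oX = replaceOracles g oZ oX ∷ replaceOraclesVec gs oZ oX

module _ {Z X Z′ X′ : Baire} {oZ oX : PR 1}
         (oZ-computes : ⟨ Z′ , oZ ⟩ computes Z from X′)
         (oX-computes : ⟨ Z′ , oX ⟩ computes X from X′) where

  mutual
    Eval-replaceOracles : ∀ {n} {e : PR n} {as v} →
                          Eval Z X e as v → Eval Z′ X′ (replaceOracles e oZ oX) as v
    Eval-replaceOracles ev-zer = ev-zer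
    Eval-replaceOracles ev-succ = ev-succ
    Eval-replaceOracles ev-proj = ev-proj
    Eval-replaceOracles (ev-oraZ {a}) = oZ-computes a
    Eval-replaceOracles (ev-oraX {a}) = oX-computes a
    Eval-replaceOracles (ev-comp gs f) = ev-comp (EvalVec-replaceOracles gs) (Eval-replaceOracles f)
    Eval-replaceOracles (ev-prec-z f) = ev-prec-z (Eval-replaceOracles f)
    Eval-replaceOracles (ev-prec-s r g) = ev-prec-s (Eval-replaceOracles r) (Eval-replaceOracles g)
    Eval-replaceOracles (ev-mu zero-at below) =
      ev-mu (Eval-replaceOracles zero-at)
            (λ z z<y → proj₁ (below z z<y) , Eval-replaceOracles (proj₂ (below z z<y)))

    EvalVec-replaceOracles : ∀ {n m} {gs : Vec (PR n) m} {as bs} →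
                             EvalVec Z X gs as bs → EvalVec Z′ X′ (replaceOraclesVec gs oZ oX) as bs
    EvalVec-replaceOracles ev-[] = ev-[]
    EvalVec-replaceOracles (ev-∷ g gs) = ev-∷ (Eval-replaceOracles g) (EvalVec-replaceOracles gs)

_∘ᶠ_ : Functional → Functional → Functional
Ψ ∘ᶠ Φ = ⟨ param Ψ ⊕ param Φ
         , replaceOracles (code Ψ) readLeft (replaceOracles (code Φ) readRight oraX) ⟩

∘ᶠ-computes : ∀ {Ψ Φ f g₁ g₂} → Ψ computes g₂ from g₁ → Φ computes g₁ from f →
              (Ψ ∘ᶠ Φ) computes g₂ from f
∘ᶠ-computes Ψ-computes Φ-computes m =
  Eval-replaceOracles readLeft-computes
    (λ n → Eval-replaceOracles readRight-computes oraX-computes (Φ-computes n))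
    (Ψ-computes m)

clamp : Baire → Functional → Functional
clamp h Φ = ⟨ param Φ ⊕ h
            , comp min-prog (replaceOracles (code Φ) readLeft oraX ∷ readRight ∷ []) ⟩

clamp-bounded : ∀ h Φ → Bounded h (clamp h Φ)
clamp-bounded h Φ x m v (ev-comp (ev-∷ {b = a} _ (ev-∷ read-h ev-[])) min-a-b)
  with refl ← Eval-deterministic read-h (readRight-computes m)
  with refl ← Eval-deterministic min-a-b (Eval-min-prog a (h m)) = m⊓n≤n a (h m)

clamp-computes : ∀ {h Φ f g} → Φ computes g from f → (∀ m → g m ≤ h m) →
                 clamp h Φ computes g from f
clamp-computes {h} {Φ} {f} {g} Φ-computes g≤h m =
  subst (Eval (param Φ ⊕ h) f (code (clamp h Φ)) (m ∷ [])) (m≤n⇒m⊓n≡m (g≤h m))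
    (ev-comp (ev-∷ (Eval-replaceOracles readLeft-computes oraX-computes (Φ-computes m))
                   (ev-∷ (readRight-computes m) ev-[]))
             (Eval-min-prog (g m) (h m)))

computes-≤-bound : ∀ {h Φ f g} → Bounded h Φ → Φ computes g from f → ∀ m → g m ≤ h m
computes-≤-bound {f = f} {g} bounded Φ-computes m = bounded f m (g m) (Φ-computes m)

module _ {I : Pred Baire 0ℓ} (ideal : IsTuringIdeal I) where
  open IsTuringIdeal ideal

  clamp-∈B : ∀ {A Φ h f g} → I (param Φ) → I h → A f → Φ computes g from f →
             (∀ m → g m ≤ h m) → B I A g
  clamp-∈B {Φ = Φ} {h} {f} Φ∈I h∈I f∈A Φ-computes g≤h =
    clamp h Φ , (join-closed Φ∈I h∈I , h , h∈I , clamp-bounded h Φ) ,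
    f , f∈A , clamp-computes Φ-computes g≤h

lemma2p33 : (A : Pred Baire 0ℓ) (I : Pred Baire 0ℓ) → IsTuringIdeal I →
    B I A ≐ B I (B I A)
lemma2p33 A I ideal = B⊆BB , BB⊆B
  where
  open IsTuringIdeal ideal

  B⊆BB : ∀ {g} → B I A g → B I (B I A) g
  B⊆BB g∈B@(Φ , (_ , h , h∈I , Φ-bounded) , f , _ , Φ-computes) =
    clamp-∈B ideal {Φ = ⟨ h , oraX ⟩} h∈I h∈I g∈B oraX-computes
      (computes-≤-bound Φ-bounded Φ-computes)

  BB⊆B : ∀ {g} → B I (B I A) g → B I A g
  BB⊆B (Ψ , (Ψ∈I , h , h∈I , Ψ-bounded) , g₁ , (Φ , (Φ∈I , _) , f , f∈A , Φ-computes) , Ψ-computes) =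
    clamp-∈B ideal {Φ = Ψ ∘ᶠ Φ} (join-closed Ψ∈I Φ∈I) h∈I f∈A
      (∘ᶠ-computes Ψ-computes Φ-computes)
      (computes-≤-bound Ψ-bounded Ψ-computes)
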